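{- Let $G$ be a connected cubic bipartite graph of girth at least $6$ such that $D_2(G)$ has a connected component isomorphic to a cocktail party graph. Then $G$ is the Möbius–Kantor graph.
   Context: For a graph $G$, the 2-distance graph $D_2(G)$ is the graph on the vertex set of $G$ in which two vertices are adjacent if and only if their distance in $G$ is exactly $2$. A cocktail party graph is a graph of the form $\overline{mK_2}$, the complement of a perfect matching on $2m$ vertices. The Möbius–Kantor graph is the generalized Petersen graph $GP(8,3)$, a cubic bipartite graph on $16$ vertices of girth $6$. -}

module Defs where

open import Data.Nat using (ℕ; zero; suc; _+_; _*_; _<_; _≤_; _%_; _≡ᵇ_)
open import Data.Bool using (Bool; true; false; _∧_; _∨_; if_then_else_; not)
open import Data.Fin using (Fin; toℕ; inject₁; fromℕ) renaming (zero to fzero; suc to fsuc)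
open import Data.List using (List; map; allFin)
open import Data.Nat.ListAction using (sum)
open import Data.Product using (Σ; _×_; _,_; ∃)
open import Data.Empty using (⊥)
open import Relation.Nullary using (¬_)
open import Relation.Binary.PropositionalEquality using (_≡_; _≢_)
open import Relation.Binary.Construct.Closure.ReflexiveTransitive using (Star)
open import Function.Definitions using (Injective)
open import Function.Bundles using (_↔_; Inverse)

record Graph (n : ℕ) : Set where
  field
    adj    : Fin n → Fin n → Bool
    sym    : ∀ u v → adj u v ≡ adj v u
    irrefl : ∀ v → adj v v ≡ false
open Graph public

Adj : ∀ {n} → Graph n → Fin n → Fin n → Set
Adj G u v = adj G u v ≡ true

data Walk {n : ℕ} (G : Graph n) : Fin n → Fin n → ℕ → Set where
  here : ∀ {u} → Walk G u u 0
  step : ∀ {u w v k} → Adj G u w → Walk G w v k → Walk G u v (suc k)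

Dist : ∀ {n} → Graph n → Fin n → Fin n → ℕ → Set
Dist G u v k = Walk G u v k × (∀ j → j < k → ¬ Walk G u v j)

Connected : ∀ {n} → Graph n → Set
Connected G = ∀ u v → ∃ λ k → Walk G u v k

degree : ∀ {n} → Graph n → Fin n → ℕ
degree {n} G v = sum (map (λ w → if adj G v w then 1 else 0) (allFin n))

Cubic : ∀ {n} → Graph n → Set
Cubic G = ∀ v → degree G v ≡ 3

Bipartite : ∀ {n} → Graph n → Set
Bipartite {n} G = Σ (Fin n → Bool) λ col → ∀ u v → Adj G u v → col u ≢ col v

-- A cycle with (suc m) distinct vertices c 0, ..., c m (m ≥ 2),
-- consecutive ones adjacent and c m adjacent to c 0.
Cycle : ∀ {n} → Graph n → ℕ → Set
Cycle {n} G m =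
  2 ≤ m × Σ (Fin (suc m) → Fin n) λ c →
    Injective _≡_ _≡_ c
    × (∀ (i : Fin m) → Adj G (c (inject₁ i)) (c (fsuc i)))
    × Adj G (c (fromℕ m)) (c fzero)

GirthAtLeast : ∀ {n} → Graph n → ℕ → Set
GirthAtLeast G g = ∀ m → suc m < g → ¬ Cycle G m

D2Adj : ∀ {n} → Graph n → Fin n → Fin n → Set
D2Adj G u v = Dist G u v 2

D2Reach : ∀ {n} → Graph n → Fin n → Fin n → Set
D2Reach G = Star (D2Adj G)

-- Cocktail party graph  complement of mK₂, vertex set Fin m × Bool,
-- the perfect matching being {(i,false),(i,true)}; so (i,a) ~ (j,b) iff i ≢ j.
CocktailAdj : (m : ℕ) → Fin m × Bool → Fin m × Bool → Set
CocktailAdj m (i , _) (j , _) = i ≢ j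

D2ComponentIsCocktail : ∀ {n} → Graph n → Fin n → ℕ → Set
D2ComponentIsCocktail {n} G v m =
  Σ (Fin m × Bool → Fin n) λ f →
    Injective _≡_ _≡_ f
    × (∀ u → (D2Reach G v u → ∃ λ x → f x ≡ u) × (∀ x → f x ≡ u → D2Reach G v u))
    × (∀ x y → (D2Adj G (f x) (f y) → CocktailAdj m x y)
              × (CocktailAdj m x y → D2Adj G (f x) (f y)))

HasCocktailD2Component : ∀ {n} → Graph n → Set
HasCocktailD2Component {n} G = Σ (Fin n) λ v → Σ ℕ λ m → D2ComponentIsCocktail G v m

-- Möbius–Kantor graph GP(8,3): vertices (i,false) = outer u_i, (i,true) = inner v_i,
-- u_i ~ u_{i±1}, u_i ~ v_i, v_i ~ v_{i±3} (indices mod 8).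
private
  plusMod8 : ℕ → Fin 8 → Fin 8 → Bool
  plusMod8 s i j = ((toℕ i + s) % 8 ≡ᵇ toℕ j) ∨ ((toℕ j + s) % 8 ≡ᵇ toℕ i)

mkAdj : Fin 8 × Bool → Fin 8 × Bool → Bool
mkAdj (i , false) (j , false) = plusMod8 1 i j
mkAdj (i , true)  (j , true)  = plusMod8 3 i j
mkAdj (i , false) (j , true)  = toℕ i ≡ᵇ toℕ j
mkAdj (i , true)  (j , false) = toℕ i ≡ᵇ toℕ j

IsMobiusKantor : ∀ {n} → Graph n → Set
IsMobiusKantor {n} G =
  Σ (Fin n ↔ (Fin 8 × Bool)) λ φ →
    ∀ u v → adj G u v ≡ mkAdj (Inverse.to φ u) (Inverse.to φ v)

module Submission where

-- Call the colour class of v points and the other class lines; girth ≥ 6 means that two points lie on at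
-- most one common line. In a cocktail party component, v has an antipode v' and is at distance 2 from every
-- other member, so the component consists of v, v' and the six points Q (ℓ , s) other than v on the three
-- lines L ℓ through v. Each Q is also collinear with v', so the three lines through v' pair the Q's up
-- across different L ℓ; after flipping sides the pairing is cyclic, M ℓ = {v', Q (ℓ , true), Q (ℓ + 1 , false)},
-- and the third line through Q (0 , s) is then forced to be R s = {Q (0 , s), Q (1 , s), Q (2 , s)}. These
-- 8 points and 8 lines span a copy of the Möbius–Kantor graph in G, and an injective homomorphism from a
-- cubic graph into a connected cubic graph is onto.

open import Defs hiding (sym)
open import Data.Nat using (ℕ; suc; _+_; _<_; s≤s; z≤n)
open import Data.Nat.DivMod using (_mod_)
open import Data.Nat.Properties using (≤-refl; n≤1+n; m<n⇒m<1+n)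
open import Data.Nat.ListAction using (sum)
open import Data.Bool using (Bool; true; false; not; _xor_; if_then_else_)
open import Data.Bool.Properties using (T-≡; ¬-not; not-¬)
import Data.Bool.Properties as Bool
open import Data.Fin using (Fin; toℕ; inject₁) renaming (suc to fsuc)
open import Data.Fin.Patterns using (0F; 1F; 2F; 3F; 4F; 5F; 6F; 7F)
open import Data.Fin.Properties using (_≟_; all?; any?)
open import Data.List using (List; []; _∷_; map; length; allFin; filterᵇ)
open import Data.List.Membership.Propositional using (_∈_)
open import Data.List.Membership.Propositional.Properties using (∈-filter⁺; ∈-filter⁻; ∈-allFin)
open import Data.List.Relation.Unary.Any using (here; there)
open import Data.List.Relation.Unary.AllPairs using ([]; _∷_)
open import Data.List.Relation.Unary.All using ([]; _∷_)
open import Data.List.Relation.Unary.Unique.Propositional using (Unique)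
open import Data.List.Relation.Unary.Unique.Propositional.Properties using (filter⁺; allFin⁺)
open import Data.Product using (Σ; _×_; _,_; ∃; ∃₂; proj₁; proj₂)
open import Data.Product.Properties using (×-≡,≡→≡; ≡-dec)
open import Data.Sum using (_⊎_; inj₁; inj₂; [_,_]′)
open import Data.Empty using (⊥; ⊥-elim)
open import Function using (_∘_; flip)
open import Function.Bundles using (Equivalence; _↔_; Inverse; mk↔ₛ′)
open import Relation.Nullary using (¬_; Dec; yes; no; contradiction)
open import Relation.Nullary.Decidable
  using (T?; toWitness; ¬?; _×-dec_; _⊎-dec_; _→-dec_; does; dec-true; dec-false; map′)
open import Relation.Binary.PropositionalEquality
open import Relation.Binary.Definitions using (DecidableEquality)
open import Relation.Binary.Construct.Closure.ReflexiveTransitive using (ε; _◅_; _◅◅_)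

private
  variable
    n : ℕ

module _ (G : Graph n) where

  Adj-sym : ∀ {u v} → Adj G u v → Adj G v u
  Adj-sym {u} {v} a = trans (Graph.sym G v u) a

  Adj⇒≢ : ∀ {u v} → Adj G u v → u ≢ v
  Adj⇒≢ {u} a refl with trans (sym a) (irrefl G u)
  ... | ()

  record Neighbours (w x y z : Fin n) : Set where
    field
      adj₁ : Adj G w x
      adj₂ : Adj G w y
      adj₃ : Adj G w z
      x≢y : x ≢ y
      x≢z : x ≢ z
      y≢z : y ≢ z
      only : ∀ {u} → Adj G w u → u ≡ x ⊎ u ≡ y ⊎ u ≡ z

  swap₁₂ : ∀ {w x y z} → Neighbours w x y z → Neighbours w y x z
  swap₁₂ N = record
    { adj₁ = adj₂ ; adj₂ = adj₁ ; adj₃ = adj₃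
    ; x≢y = x≢y ∘ sym ; x≢z = y≢z ; y≢z = x≢z
    ; only = λ a → case (only a) }
    where
      open Neighbours N
      case : ∀ {u x y z : Fin n} → u ≡ x ⊎ u ≡ y ⊎ u ≡ z → u ≡ y ⊎ u ≡ x ⊎ u ≡ z
      case (inj₁ e) = inj₂ (inj₁ e)
      case (inj₂ (inj₁ e)) = inj₁ e
      case (inj₂ (inj₂ e)) = inj₂ (inj₂ e)

  swap₂₃ : ∀ {w x y z} → Neighbours w x y z → Neighbours w x z y
  swap₂₃ N = record
    { adj₁ = adj₁ ; adj₂ = adj₃ ; adj₃ = adj₂
    ; x≢y = x≢z ; x≢z = x≢y ; y≢z = y≢z ∘ sym
    ; only = λ a → case (only a) }
    where
      open Neighbours N
      case : ∀ {u x y z : Fin n} → u ≡ x ⊎ u ≡ y ⊎ u ≡ z → u ≡ x ⊎ u ≡ z ⊎ u ≡ y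
      case (inj₁ e) = inj₁ e
      case (inj₂ (inj₁ e)) = inj₂ (inj₂ e)
      case (inj₂ (inj₂ e)) = inj₂ (inj₁ e)

  Neighbours⇒injective : ∀ {w} (f : Fin 3 → Fin n) → Neighbours w (f 0F) (f 1F) (f 2F) →
                         ∀ {i j} → f i ≡ f j → i ≡ j
  Neighbours⇒injective f N {0F} {0F} _ = refl
  Neighbours⇒injective f N {0F} {1F} e = ⊥-elim (Neighbours.x≢y N e)
  Neighbours⇒injective f N {0F} {2F} e = ⊥-elim (Neighbours.x≢z N e)
  Neighbours⇒injective f N {1F} {0F} e = ⊥-elim (Neighbours.x≢y N (sym e))
  Neighbours⇒injective f N {1F} {1F} _ = refl
  Neighbours⇒injective f N {1F} {2F} e = ⊥-elim (Neighbours.y≢z N e)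
  Neighbours⇒injective f N {2F} {0F} e = ⊥-elim (Neighbours.x≢z N (sym e))
  Neighbours⇒injective f N {2F} {1F} e = ⊥-elim (Neighbours.y≢z N (sym e))
  Neighbours⇒injective f N {2F} {2F} _ = refl

  common-neighbour-unique : GirthAtLeast G 5 → ∀ {a b c d} → a ≢ c →
    Adj G a b → Adj G b c → Adj G a d → Adj G d c → b ≡ d
  common-neighbour-unique girth {a} {b} {c} {d} a≢c ab bc ad dc with b ≟ d
  ... | yes b≡d = b≡d
  ... | no b≢d = ⊥-elim (girth 3 ≤-refl (n≤1+n 2 , cycle , injective , edges , Adj-sym ad))
    where
      cycle : Fin 4 → Fin n
      cycle 0F = a
      cycle 1F = b
      cycle 2F = c
      cycle 3F = d
      injective : ∀ {i j} → cycle i ≡ cycle j → i ≡ j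
      injective {0F} {0F} _ = refl
      injective {0F} {1F} e = ⊥-elim (Adj⇒≢ ab e)
      injective {0F} {2F} e = ⊥-elim (a≢c e)
      injective {0F} {3F} e = ⊥-elim (Adj⇒≢ ad e)
      injective {1F} {0F} e = ⊥-elim (Adj⇒≢ ab (sym e))
      injective {1F} {1F} _ = refl
      injective {1F} {2F} e = ⊥-elim (Adj⇒≢ bc e)
      injective {1F} {3F} e = ⊥-elim (b≢d e)
      injective {2F} {0F} e = ⊥-elim (a≢c (sym e))
      injective {2F} {1F} e = ⊥-elim (Adj⇒≢ bc (sym e))
      injective {2F} {2F} _ = refl
      injective {2F} {3F} e = ⊥-elim (Adj⇒≢ dc (sym e))
      injective {3F} {0F} e = ⊥-elim (Adj⇒≢ ad (sym e))
      injective {3F} {1F} e = ⊥-elim (b≢d (sym e))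
      injective {3F} {2F} e = ⊥-elim (Adj⇒≢ dc e)
      injective {3F} {3F} _ = refl
      edges : ∀ (i : Fin 3) → Adj G (cycle (inject₁ i)) (cycle (fsuc i))
      edges 0F = ab
      edges 1F = bc
      edges 2F = Adj-sym dc

sum-indicator≡length-filter : ∀ {A : Set} (f : A → Bool) (xs : List A) →
  sum (map (λ x → if f x then 1 else 0) xs) ≡ length (filterᵇ f xs)
sum-indicator≡length-filter f [] = refl
sum-indicator≡length-filter f (x ∷ xs) with f x
... | true = cong suc (sum-indicator≡length-filter f xs)
... | false = sum-indicator≡length-filter f xs

module _ {G : Graph n} (cubic : Cubic G) where

  neighbours : ∀ w → ∃ λ x → ∃₂ λ y z → Neighbours G w x y z
  neighbours w =
    fromList (filterᵇ (adj G w) (allFin _)) length≡3 (filter⁺ (T? ∘ adj G w) (allFin⁺ _)) complete sound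
    where
      length≡3 : length (filterᵇ (adj G w) (allFin _)) ≡ 3
      length≡3 = trans (sym (sum-indicator≡length-filter (adj G w) (allFin _))) (cubic w)

      complete : ∀ {u} → Adj G w u → u ∈ filterᵇ (adj G w) (allFin _)
      complete {u} a = ∈-filter⁺ (T? ∘ adj G w) (∈-allFin u) (Equivalence.from T-≡ a)

      sound : ∀ {u} → u ∈ filterᵇ (adj G w) (allFin _) → Adj G w u
      sound u∈ = Equivalence.to T-≡ (proj₂ (∈-filter⁻ (T? ∘ adj G w) {xs = allFin _} u∈))

      fromList : (xs : List (Fin _)) → length xs ≡ 3 → Unique xs →
                 (∀ {u} → Adj G w u → u ∈ xs) → (∀ {u} → u ∈ xs → Adj G w u) →
                 ∃ λ x → ∃₂ λ y z → Neighbours G w x y z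
      fromList (x ∷ y ∷ z ∷ []) refl ((x≢y ∷ x≢z ∷ []) ∷ (y≢z ∷ []) ∷ [] ∷ []) complete sound =
        x , y , z , record
          { adj₁ = sound (here refl) ; adj₂ = sound (there (here refl)) ; adj₃ = sound (there (there (here refl)))
          ; x≢y = x≢y ; x≢z = x≢z ; y≢z = y≢z ; only = only ∘ complete }
        where
          only : ∀ {u} → u ∈ x ∷ y ∷ z ∷ [] → u ≡ x ⊎ u ≡ y ⊎ u ≡ z
          only (here e) = inj₁ e
          only (there (here e)) = inj₂ (inj₁ e)
          only (there (there (here e))) = inj₂ (inj₂ e)

  neighbours-via : ∀ {w a} → Adj G w a → ∃₂ λ b c → Neighbours G w a b c
  neighbours-via {w} w~a with neighbours w
  ... | x , y , z , N with Neighbours.only N w~a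
  ... | inj₁ refl = y , z , N
  ... | inj₂ (inj₁ refl) = x , z , swap₁₂ G N
  ... | inj₂ (inj₂ refl) = x , y , swap₁₂ G (swap₂₃ G N)

  neighbours-via₂ : ∀ {w a b} → Adj G w a → Adj G w b → a ≢ b → ∃ λ c → Neighbours G w a b c
  neighbours-via₂ w~a w~b a≢b with neighbours-via w~a
  ... | y , z , N with Neighbours.only N w~b
  ... | inj₁ refl = ⊥-elim (a≢b refl)
  ... | inj₂ (inj₁ refl) = z , N
  ... | inj₂ (inj₂ refl) = y , swap₂₃ G N

  neighbours-via₃ : ∀ {w a b c} → Adj G w a → Adj G w b → Adj G w c → a ≢ b → a ≢ c → b ≢ c →
                    Neighbours G w a b c
  neighbours-via₃ w~a w~b w~c a≢b a≢c b≢c with neighbours-via₂ w~a w~b a≢b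
  ... | z , N with Neighbours.only N w~c
  ... | inj₁ refl = ⊥-elim (a≢c refl)
  ... | inj₂ (inj₁ refl) = ⊥-elim (b≢c refl)
  ... | inj₂ (inj₂ refl) = N

module _ {A : Set} {G : Graph n} (cubic : Cubic G) (connected : Connected G)
  (H : A → A → Bool) (ν : A → Fin 3 → A)
  (ν-adjacent : ∀ x i → H x (ν x i) ≡ true) (ν-injective : ∀ x {i j} → ν x i ≡ ν x j → i ≡ j)
  (ψ : A → Fin n) (ψ-injective : ∀ {x y} → ψ x ≡ ψ y → x ≡ y)
  (ψ-hom : ∀ x y → H x y ≡ true → Adj G (ψ x) (ψ y)) where

  private
    ψν-distinct : ∀ x {i j} → i ≢ j → ψ (ν x i) ≢ ψ (ν x j)
    ψν-distinct x i≢j = i≢j ∘ ν-injective x ∘ ψ-injective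

    image-neighbours : ∀ x → Neighbours G (ψ x) (ψ (ν x 0F)) (ψ (ν x 1F)) (ψ (ν x 2F))
    image-neighbours x = neighbours-via₃ cubic (hom 0F) (hom 1F) (hom 2F)
      (ψν-distinct x λ ()) (ψν-distinct x λ ()) (ψν-distinct x λ ())
      where hom = λ i → ψ-hom x (ν x i) (ν-adjacent x i)

    neighbour-in-image : ∀ x {w} → Adj G (ψ x) w → ∃ λ i → ψ (ν x i) ≡ w
    neighbour-in-image x a with Neighbours.only (image-neighbours x) a
    ... | inj₁ e = 0F , sym e
    ... | inj₂ (inj₁ e) = 1F , sym e
    ... | inj₂ (inj₂ e) = 2F , sym e

    walk-in-image : ∀ {u w k} → Walk G u w k → ∀ x → ψ x ≡ u → ∃ λ y → ψ y ≡ w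
    walk-in-image here x e = x , e
    walk-in-image (step a walk) x refl with neighbour-in-image x a
    ... | i , e = walk-in-image walk (ν x i) e

    adj-ψ : ∀ x y → adj G (ψ x) (ψ y) ≡ H x y
    adj-ψ x y with H x y in Hxy
    ... | true = ψ-hom x y Hxy
    ... | false with adj G (ψ x) (ψ y) in a
    ...   | false = refl
    ...   | true with neighbour-in-image x a
    ...     | i , e =
      contradiction (trans (sym Hxy) (subst (λ y → H x y ≡ true) (ψ-injective e) (ν-adjacent x i))) λ ()

  injective-hom⇒iso : A → Σ (Fin n ↔ A) λ φ → ∀ u w → adj G u w ≡ H (Inverse.to φ u) (Inverse.to φ w)
  injective-hom⇒iso x₀ = φ , λ u w → begin
      adj G u w                  ≡⟨ cong₂ (adj G) (sym (proj₂ (preimage u))) (sym (proj₂ (preimage w))) ⟩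
      adj G (ψ (to u)) (ψ (to w)) ≡⟨ adj-ψ (to u) (to w) ⟩
      H (to u) (to w)            ∎
    where
      open ≡-Reasoning
      preimage : ∀ u → ∃ λ x → ψ x ≡ u
      preimage u = walk-in-image (proj₂ (connected (ψ x₀) u)) x₀ refl
      to : Fin n → A
      to = proj₁ ∘ preimage
      φ : Fin n ↔ A
      φ = mk↔ₛ′ to ψ (λ x → ψ-injective (proj₂ (preimage (ψ x)))) (proj₂ ∘ preimage)

module _ {G : Graph n} where

  walk₀ : ∀ {u v} → Walk G u v 0 → u ≡ v
  walk₀ here = refl

  walk₁ : ∀ {u v} → Walk G u v 1 → Adj G u v
  walk₁ (step a here) = a

  D2Adj⇒≢ : ∀ {u v} → D2Adj G u v → u ≢ v
  D2Adj⇒≢ (_ , shorter) refl = shorter 0 (s≤s z≤n) here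

  D2Adj⇒path : ∀ {u v} → D2Adj G u v → ∃ λ w → Adj G u w × Adj G w v
  D2Adj⇒path (step a (step b here) , _) = _ , a , b

  module _ {col : Fin n → Bool} (proper : ∀ u v → Adj G u v → col u ≢ col v) where

    path₂⇒same-colour : ∀ {u w v} → Adj G u w → Adj G w v → col u ≡ col v
    path₂⇒same-colour {u} {w} {v} a b = trans (¬-not (proper u w a)) (sym (¬-not (proper w v b ∘ sym)))

    D2Adj-intro : ∀ {u w v} → Adj G u w → Adj G w v → u ≢ v → D2Adj G u v
    D2Adj-intro {u} {w} {v} a b u≢v = step a (step b here) , shorter
      where
        shorter : ∀ j → j < 2 → ¬ Walk G u v j
        shorter 0 _ walk = u≢v (walk₀ walk)
        shorter 1 _ walk = proper u v (walk₁ walk) (path₂⇒same-colour a b)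
        shorter (suc (suc _)) (s≤s (s≤s ())) _

    D2Reach⇒same-colour : ∀ {u v} → D2Reach G u v → col u ≡ col v
    D2Reach⇒same-colour ε = refl
    D2Reach⇒same-colour (d ◅ r) =
      let _ , a , b = D2Adj⇒path d in trans (path₂⇒same-colour a b) (D2Reach⇒same-colour r)

record Antipodes (G : Graph n) (v v' : Fin n) : Set where
  field
    v≢v' : v ≢ v'
    ¬D2Adj : ¬ D2Adj G v v'
    component : ∀ {u} → D2Reach G v u → u ≡ v ⊎ u ≡ v' ⊎ D2Adj G v u
    shared : ∀ {u} → D2Adj G v u → D2Adj G v' u

cocktail-antipodes : ∀ {G : Graph n} {v m} → D2ComponentIsCocktail G v m → ∃ (Antipodes G v)
cocktail-antipodes {G = G} {v} (f , f-injective , onto , iso) with proj₁ (onto v) ε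
... | (i , b) , refl = f (i , not b) , record
  { v≢v' = not-¬ refl ∘ cong proj₂ ∘ f-injective
  ; ¬D2Adj = λ d → proj₁ (iso _ _) d refl
  ; component = component
  ; shared = shared }
  where
    component : ∀ {u} → D2Reach G (f (i , b)) u → u ≡ f (i , b) ⊎ u ≡ f (i , not b) ⊎ D2Adj G (f (i , b)) u
    component reach with proj₁ (onto _) reach
    ... | (j , c) , refl with i ≟ j
    ...   | no i≢j = inj₂ (inj₂ (proj₂ (iso _ _) i≢j))
    ...   | yes refl with b Bool.≟ c
    ...     | yes refl = inj₁ refl
    ...     | no b≢c = inj₂ (inj₁ (cong (λ c → f (i , c)) (¬-not (b≢c ∘ sym))))
    shared : ∀ {u} → D2Adj G (f (i , b)) u → D2Adj G (f (i , not b)) u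
    shared d with proj₁ (onto _) (d ◅ ε)
    ... | y , refl = proj₂ (iso _ _) (proj₁ (iso _ y) d)

next prev : Fin 3 → Fin 3
next 0F = 1F
next 1F = 2F
next 2F = 0F
prev 0F = 2F
prev 1F = 0F
prev 2F = 1F

prev-next : ∀ ℓ → prev (next ℓ) ≡ ℓ
prev-next 0F = refl
prev-next 1F = refl
prev-next 2F = refl

next-line : ∀ ℓ k → k ≢ ℓ → k ≢ prev ℓ → k ≡ next ℓ
next-line = toWitness {a? = all? λ ℓ → all? λ k → ¬? (k ≟ ℓ) →-dec ¬? (k ≟ prev ℓ) →-dec k ≟ next ℓ} _

third-line : ∀ (ℓ k : Fin 3) → ℓ ≢ k → ∃ λ j → j ≢ ℓ × j ≢ k × (∀ x → x ≢ j → x ≡ ℓ ⊎ x ≡ k)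
third-line = toWitness {a? = all? λ ℓ → all? λ k → ¬? (ℓ ≟ k) →-dec any? λ j →
  ¬? (j ≟ ℓ) ×-dec ¬? (j ≟ k) ×-dec all? λ x → ¬? (x ≟ j) →-dec (x ≟ ℓ ⊎-dec x ≟ k)} _

module _ (π : Fin 3 × Bool → Fin 3 × Bool)
  (π-involutive : ∀ x → π (π x) ≡ x) (π-crosses : ∀ x → proj₁ (π x) ≢ proj₁ x) where

  private
    π-injective : ∀ {x y} → π x ≡ π y → x ≡ y
    π-injective {x} {y} e = trans (sym (π-involutive x)) (trans (cong π e) (π-involutive y))

    paired-back : ∀ {ℓ k} → (∀ s → proj₁ (π (ℓ , s)) ≡ k) → ∀ {y} → proj₁ y ≡ k → proj₁ (π y) ≡ ℓ
    paired-back {ℓ} {k} into-k {k , s} refl = [ hit , hit ]′ sides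
      where
        hit : ∀ {b} → s ≡ proj₂ (π (ℓ , b)) → proj₁ (π (k , s)) ≡ ℓ
        hit {b} e = trans (cong (proj₁ ∘ π) (×-≡,≡→≡ (sym (into-k b) , e))) (cong proj₁ (π-involutive (ℓ , b)))
        b₁≢b₀ : proj₂ (π (ℓ , true)) ≢ proj₂ (π (ℓ , false))
        b₁≢b₀ e with π-injective (×-≡,≡→≡ (trans (into-k true) (sym (into-k false)) , e))
        ... | ()
        sides : s ≡ proj₂ (π (ℓ , false)) ⊎ s ≡ proj₂ (π (ℓ , true))
        sides with s Bool.≟ proj₂ (π (ℓ , false))
        ... | yes s≡b₀ = inj₁ s≡b₀
        ... | no s≢b₀ = inj₂ (trans (¬-not s≢b₀) (sym (¬-not b₁≢b₀)))

  partner-lines-differ : ∀ ℓ → proj₁ (π (ℓ , false)) ≢ proj₁ (π (ℓ , true))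
  partner-lines-differ ℓ same = contradict (third-line ℓ k (π-crosses (ℓ , false) ∘ sym))
    where
      k = proj₁ (π (ℓ , false))
      into-k : ∀ s → proj₁ (π (ℓ , s)) ≡ k
      into-k false = refl
      into-k true = sym same
      from-ℓ : ∀ {y} → proj₁ y ≡ ℓ → proj₁ (π y) ≡ k
      from-ℓ {_ , s} refl = into-k s
      contradict : ∃ (λ j → j ≢ ℓ × j ≢ k × (∀ x → x ≢ j → x ≡ ℓ ⊎ x ≡ k)) → ⊥
      contradict (j , j≢ℓ , j≢k , lines) =
        [ (λ on-ℓ → j≢k (trans back (from-ℓ on-ℓ))) , (λ on-k → j≢ℓ (trans back (paired-back into-k on-k))) ]′
          (lines (proj₁ (π (j , false))) (π-crosses (j , false)))
        where back = sym (cong proj₁ (π-involutive (j , false)))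

  flips : Fin 3 → Bool
  flips ℓ = does (proj₁ (π (ℓ , true)) ≟ prev ℓ)

  private
    partner-line : ∀ ℓ → proj₁ (π (ℓ , not (flips ℓ))) ≡ next ℓ
    partner-line ℓ with proj₁ (π (ℓ , true)) ≟ prev ℓ
    ... | yes on-prev = next-line ℓ _ (π-crosses (ℓ , false)) (partner-lines-differ ℓ ∘ flip trans (sym on-prev))
    ... | no ¬on-prev = next-line ℓ _ (π-crosses (ℓ , true)) ¬on-prev

    partner-side : ∀ ℓ → proj₂ (π (ℓ , not (flips ℓ))) ≡ flips (next ℓ)
    partner-side ℓ = side _ back
      where
        x = (ℓ , not (flips ℓ))
        back : proj₁ (π (next ℓ , proj₂ (π x))) ≡ prev (next ℓ)
        back = begin
          proj₁ (π (next ℓ , proj₂ (π x))) ≡⟨ cong (proj₁ ∘ π) (×-≡,≡→≡ (sym (partner-line ℓ) , refl)) ⟩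
          proj₁ (π (π x))                  ≡⟨ cong proj₁ (π-involutive x) ⟩
          ℓ                                ≡⟨ sym (prev-next ℓ) ⟩
          prev (next ℓ)                    ∎
          where open ≡-Reasoning
        side : ∀ b → proj₁ (π (next ℓ , b)) ≡ prev (next ℓ) → b ≡ flips (next ℓ)
        side true e = sym (dec-true (_ ≟ _) e)
        side false e = sym (dec-false (_ ≟ _) (partner-lines-differ (next ℓ) ∘ trans e ∘ sym))

  pairing-normal-form : ∀ ℓ → π (ℓ , not (flips ℓ)) ≡ (next ℓ , flips (next ℓ))
  pairing-normal-form ℓ = ×-≡,≡→≡ (partner-line ℓ , partner-side ℓ)

∀-Bool? : {P : Bool → Set} → (∀ b → Dec (P b)) → Dec (∀ b → P b)
∀-Bool? P? = map′ (λ (f , t) → λ { false → f ; true → t }) (λ h → h false , h true) (P? false ×-dec P? true)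

∀-Fin×Bool? : ∀ {m} {P : Fin m × Bool → Set} → (∀ x → Dec (P x)) → Dec (∀ x → P x)
∀-Fin×Bool? P? = map′ (λ h (i , b) → h i b) (λ h i b → h (i , b)) (all? λ i → ∀-Bool? λ b → P? (i , b))

_≟ₓ_ : ∀ {m} → DecidableEquality (Fin m × Bool)
_≟ₓ_ = ≡-dec _≟_ Bool._≟_

-- The partner of Q x on its M-line, once the pairing is in normal form.
mate : Fin 3 × Bool → Fin 3 × Bool
mate (ℓ , true) = next ℓ , false
mate (ℓ , false) = prev ℓ , true

Collinear : Fin 3 × Bool → Fin 3 × Bool → Set
Collinear x y = proj₁ x ≡ proj₁ y ⊎ y ≡ mate x

non-collinear-triple : ∀ s y z → ¬ Collinear (0F , s) y → ¬ Collinear (0F , s) z → ¬ Collinear y z →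
                       (y ≡ (1F , s) × z ≡ (2F , s)) ⊎ (y ≡ (2F , s) × z ≡ (1F , s))
non-collinear-triple = toWitness {a? = ∀-Bool? λ s → ∀-Fin×Bool? λ y → ∀-Fin×Bool? λ z →
  ¬? (collinear? (0F , s) y) →-dec ¬? (collinear? (0F , s) z) →-dec ¬? (collinear? y z) →-dec
  ((y ≟ₓ (1F , s) ×-dec z ≟ₓ (2F , s)) ⊎-dec (y ≟ₓ (2F , s) ×-dec z ≟ₓ (1F , s)))} _
  where
    collinear? : ∀ x y → Dec (Collinear x y)
    collinear? x y = proj₁ x ≟ proj₁ y ⊎-dec y ≟ₓ mate x

three-on-a-line : ∀ {x y z : Fin 3 × Bool} → proj₁ x ≡ proj₁ y → proj₁ x ≡ proj₁ z →
                  x ≢ y → x ≢ z → y ≢ z → ⊥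
three-on-a-line {ℓ , a} {ℓ , b} {ℓ , c} refl refl x≢y x≢z y≢z =
  y≢z (cong (ℓ ,_) (trans (¬-not (x≢y ∘ cong (ℓ ,_) ∘ sym)) (sym (¬-not (x≢z ∘ cong (ℓ ,_) ∘ sym)))))

data Point : Set where
  p₀ p₁ : Point
  q : Fin 3 → Bool → Point

data Line : Set where
  l m : Fin 3 → Line
  r : Bool → Line

pointsOn : Line → Fin 3 → Point
pointsOn (l ℓ) 0F = p₀
pointsOn (l ℓ) 1F = q ℓ false
pointsOn (l ℓ) 2F = q ℓ true
pointsOn (m ℓ) 0F = p₁
pointsOn (m ℓ) 1F = q ℓ true
pointsOn (m ℓ) 2F = q (next ℓ) false
pointsOn (r s) i = q i s

p₀∉m : ∀ {k} → ∃ (λ j → pointsOn (m k) j ≡ p₀) → ⊥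
p₀∉m (0F , ())
p₀∉m (1F , ())
p₀∉m (2F , ())

p₁∉l : ∀ {k} → ∃ (λ j → pointsOn (l k) j ≡ p₁) → ⊥
p₁∉l (0F , ())
p₁∉l (1F , ())
p₁∉l (2F , ())

Label : Set
Label = Fin 8 × Bool

shift : ℕ → Fin 8 → Fin 8
shift k i = (toℕ i + k) mod 8

mk-neighbours : Label → Fin 3 → Label
mk-neighbours (i , false) 0F = shift 1 i , false
mk-neighbours (i , false) 1F = shift 7 i , false
mk-neighbours (i , false) 2F = i , true
mk-neighbours (i , true) 0F = shift 3 i , true
mk-neighbours (i , true) 1F = shift 5 i , true
mk-neighbours (i , true) 2F = i , false

-- An isomorphism of the configuration with GP(8,3), sending p₀ to u₀ and its antipode p₁ to u₄.
unlabel : Label → Point ⊎ Line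
unlabel (0F , false) = inj₁ p₀
unlabel (1F , false) = inj₂ (l 0F)
unlabel (2F , false) = inj₁ (q 0F false)
unlabel (3F , false) = inj₂ (m 2F)
unlabel (4F , false) = inj₁ p₁
unlabel (5F , false) = inj₂ (m 1F)
unlabel (6F , false) = inj₁ (q 1F true)
unlabel (7F , false) = inj₂ (l 1F)
unlabel (0F , true) = inj₂ (l 2F)
unlabel (1F , true) = inj₁ (q 0F true)
unlabel (2F , true) = inj₂ (r false)
unlabel (3F , true) = inj₁ (q 2F true)
unlabel (4F , true) = inj₂ (m 0F)
unlabel (5F , true) = inj₁ (q 2F false)
unlabel (6F , true) = inj₂ (r true)
unlabel (7F , true) = inj₁ (q 1F false)

label : Point ⊎ Line → Label
label (inj₁ p₀) = 0F , false
label (inj₁ p₁) = 4F , false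
label (inj₁ (q 0F false)) = 2F , false
label (inj₁ (q 0F true)) = 1F , true
label (inj₁ (q 1F false)) = 7F , true
label (inj₁ (q 1F true)) = 6F , false
label (inj₁ (q 2F false)) = 5F , true
label (inj₁ (q 2F true)) = 3F , true
label (inj₂ (l 0F)) = 1F , false
label (inj₂ (l 1F)) = 7F , false
label (inj₂ (l 2F)) = 0F , true
label (inj₂ (m 0F)) = 4F , true
label (inj₂ (m 1F)) = 5F , false
label (inj₂ (m 2F)) = 3F , false
label (inj₂ (r false)) = 2F , true
label (inj₂ (r true)) = 6F , true

unlabel-label : ∀ a → unlabel (label a) ≡ a
unlabel-label (inj₁ p₀) = refl
unlabel-label (inj₁ p₁) = refl
unlabel-label (inj₁ (q 0F false)) = refl
unlabel-label (inj₁ (q 0F true)) = refl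
unlabel-label (inj₁ (q 1F false)) = refl
unlabel-label (inj₁ (q 1F true)) = refl
unlabel-label (inj₁ (q 2F false)) = refl
unlabel-label (inj₁ (q 2F true)) = refl
unlabel-label (inj₂ (l 0F)) = refl
unlabel-label (inj₂ (l 1F)) = refl
unlabel-label (inj₂ (l 2F)) = refl
unlabel-label (inj₂ (m 0F)) = refl
unlabel-label (inj₂ (m 1F)) = refl
unlabel-label (inj₂ (m 2F)) = refl
unlabel-label (inj₂ (r false)) = refl
unlabel-label (inj₂ (r true)) = refl

label-unlabel : ∀ x → label (unlabel x) ≡ x
label-unlabel = toWitness {a? = ∀-Fin×Bool? λ x → label (unlabel x) ≟ₓ x} _

mk-neighbours-adjacent : ∀ x i → mkAdj x (mk-neighbours x i) ≡ true
mk-neighbours-adjacent = toWitness {a? = ∀-Fin×Bool? λ x → all? λ i → mkAdj x (mk-neighbours x i) Bool.≟ true} _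

mk-neighbours-injective : ∀ x {i j} → mk-neighbours x i ≡ mk-neighbours x j → i ≡ j
mk-neighbours-injective = λ x {i} {j} → injective x i j
  where
    injective : ∀ x i j → mk-neighbours x i ≡ mk-neighbours x j → i ≡ j
    injective = toWitness {a? = ∀-Fin×Bool? λ x → all? λ i → all? λ j →
      mk-neighbours x i ≟ₓ mk-neighbours x j →-dec i ≟ j} _

OnLine : Point ⊎ Line → Label → Set
OnLine (inj₁ _) y = ⊥
OnLine (inj₂ b) y = ∃ λ i → y ≡ label (inj₁ (pointsOn b i))

mk-edges-are-incidences : ∀ x y → mkAdj x y ≡ true → OnLine (unlabel x) y ⊎ OnLine (unlabel y) x
mk-edges-are-incidences = toWitness {a? = ∀-Fin×Bool? λ x → ∀-Fin×Bool? λ y →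
  mkAdj x y Bool.≟ true →-dec (onLine? (unlabel x) y ⊎-dec onLine? (unlabel y) x)} _
  where
    onLine? : ∀ a y → Dec (OnLine a y)
    onLine? (inj₁ _) y = no λ ()
    onLine? (inj₂ b) y = any? λ i → y ≟ₓ label (inj₁ (pointsOn b i))

record Local (G : Graph n) (v : Fin n) : Set where
  field
    L : Fin 3 → Fin n
    Q : Fin 3 × Bool → Fin n
    v-nbhd : Neighbours G v (L 0F) (L 1F) (L 2F)
    L-nbhd : ∀ ℓ → Neighbours G (L ℓ) v (Q (ℓ , false)) (Q (ℓ , true))

  v~L : ∀ ℓ → Adj G v (L ℓ)
  v~L 0F = Neighbours.adj₁ v-nbhd
  v~L 1F = Neighbours.adj₂ v-nbhd
  v~L 2F = Neighbours.adj₃ v-nbhd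

  L~Q : ∀ x → Adj G (L (proj₁ x)) (Q x)
  L~Q (ℓ , false) = Neighbours.adj₂ (L-nbhd ℓ)
  L~Q (ℓ , true) = Neighbours.adj₃ (L-nbhd ℓ)

local-at : ∀ {G : Graph n} → Cubic G → ∀ v → Local G v
local-at {G = G} cubic v with neighbours cubic v
... | a , b , c , N = record { L = L ; Q = Q ; v-nbhd = N ; L-nbhd = proj₂ ∘ proj₂ ∘ around }
  where
    L : Fin 3 → Fin _
    L 0F = a
    L 1F = b
    L 2F = c
    around : ∀ ℓ → ∃₂ λ x y → Neighbours G (L ℓ) v x y
    around 0F = neighbours-via cubic (Adj-sym G (Neighbours.adj₁ N))
    around 1F = neighbours-via cubic (Adj-sym G (Neighbours.adj₂ N))
    around 2F = neighbours-via cubic (Adj-sym G (Neighbours.adj₃ N))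
    Q : Fin 3 × Bool → Fin _
    Q (ℓ , false) = proj₁ (around ℓ)
    Q (ℓ , true) = proj₁ (proj₂ (around ℓ))

flip-sides : ∀ {G : Graph n} {v} → Local G v → (Fin 3 → Bool) → Local G v
flip-sides {G = G} loc t = record loc
  { Q = λ (ℓ , s) → Q (ℓ , s xor t ℓ)
  ; L-nbhd = λ ℓ → sides ℓ (t ℓ) }
  where
    open Local loc
    sides : ∀ ℓ b → Neighbours G (L ℓ) _ (Q (ℓ , b)) (Q (ℓ , not b))
    sides ℓ false = L-nbhd ℓ
    sides ℓ true = swap₂₃ G (L-nbhd ℓ)

module LocalFacts {G : Graph n} {col : Fin n → Bool} (proper : ∀ u w → Adj G u w → col u ≢ col w)
  (girth : GirthAtLeast G 5) {v v'} (antipodes : Antipodes G v v') (loc : Local G v) where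

  open Local loc public
  open Antipodes antipodes public

  same-line : ∀ {x y w w'} → x ≢ y → Adj G w x → Adj G w y → Adj G w' x → Adj G w' y → w ≡ w'
  same-line x≢y wx wy w'x w'y = common-neighbour-unique G girth x≢y (Adj-sym G wx) wy (Adj-sym G w'x) w'y

  v≢Q : ∀ x → v ≢ Q x
  v≢Q (ℓ , false) = Neighbours.x≢y (L-nbhd ℓ)
  v≢Q (ℓ , true) = Neighbours.x≢z (L-nbhd ℓ)

  Q-D2 : ∀ x → D2Adj G v (Q x)
  Q-D2 x = D2Adj-intro proper (v~L (proj₁ x)) (L~Q x) (v≢Q x)

  Q-reach : ∀ x → D2Reach G v (Q x)
  Q-reach x = Q-D2 x ◅ ε

  v'≢Q : ∀ x → v' ≢ Q x
  v'≢Q x e = ¬D2Adj (subst (D2Adj G v) (sym e) (Q-D2 x))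

  L-injective : ∀ {ℓ k} → L ℓ ≡ L k → ℓ ≡ k
  L-injective = Neighbours⇒injective G L v-nbhd

  Q-injective : ∀ {x y} → Q x ≡ Q y → x ≡ y
  Q-injective {ℓ , s} {k , t} e with ℓ ≟ k
  ... | no ℓ≢k = ⊥-elim (ℓ≢k (L-injective (same-line (v≢Q (ℓ , s)) (Adj-sym G (v~L ℓ)) (L~Q (ℓ , s))
                   (Adj-sym G (v~L k)) (subst (Adj G (L k)) (sym e) (L~Q (k , t))))))
  ... | yes refl = cong (ℓ ,_) (sides s t e)
    where
      sides : ∀ s t → Q (ℓ , s) ≡ Q (ℓ , t) → s ≡ t
      sides false false _ = refl
      sides false true e = ⊥-elim (Neighbours.y≢z (L-nbhd ℓ) e)
      sides true false e = ⊥-elim (Neighbours.y≢z (L-nbhd ℓ) (sym e))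
      sides true true _ = refl

  on-L : ∀ {ℓ u} → Adj G (L ℓ) u → u ≡ v ⊎ ∃ λ s → u ≡ Q (ℓ , s)
  on-L {ℓ} a with Neighbours.only (L-nbhd ℓ) a
  ... | inj₁ e = inj₁ e
  ... | inj₂ (inj₁ e) = inj₂ (false , e)
  ... | inj₂ (inj₂ e) = inj₂ (true , e)

  Q-on-L : ∀ {ℓ x} → Adj G (L ℓ) (Q x) → proj₁ x ≡ ℓ
  Q-on-L a with on-L a
  ... | inj₁ e = ⊥-elim (v≢Q _ (sym e))
  ... | inj₂ (_ , e) = cong proj₁ (Q-injective e)

  through-v : ∀ {w} → Adj G v w → ∃ λ ℓ → w ≡ L ℓ
  through-v a with Neighbours.only v-nbhd a
  ... | inj₁ e = 0F , e
  ... | inj₂ (inj₁ e) = 1F , e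
  ... | inj₂ (inj₂ e) = 2F , e

  component-points : ∀ {u} → D2Reach G v u → u ≡ v ⊎ u ≡ v' ⊎ ∃ λ x → u ≡ Q x
  component-points reach with component reach
  ... | inj₁ e = inj₁ e
  ... | inj₂ (inj₁ e) = inj₂ (inj₁ e)
  ... | inj₂ (inj₂ d) with D2Adj⇒path d
  ...   | w , v~w , w~u with through-v v~w
  ...     | ℓ , refl with on-L w~u
  ...       | inj₁ u≡v = ⊥-elim (D2Adj⇒≢ d (sym u≡v))
  ...       | inj₂ (s , e) = inj₂ (inj₂ ((ℓ , s) , e))

  collinear-points : ∀ {w a b} → D2Reach G v a → Adj G w a → Adj G w b → a ≢ b →
                     b ≡ v ⊎ b ≡ v' ⊎ ∃ λ x → b ≡ Q x
  collinear-points reach wa wb a≢b = component-points (reach ◅◅ (D2Adj-intro proper (Adj-sym G wa) wb a≢b ◅ ε))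

record Skeleton (G : Graph n) (v v' : Fin n) : Set where
  field
    local : Local G v
    M : Fin 3 → Fin n
    M-nbhd : ∀ ℓ → Neighbours G (M ℓ) v' (Local.Q local (ℓ , true)) (Local.Q local (next ℓ , false))

module _ {G : Graph n} (cubic : Cubic G) {col : Fin n → Bool} (proper : ∀ u w → Adj G u w → col u ≢ col w)
  (girth : GirthAtLeast G 5) {v v'} (antipodes : Antipodes G v v') (loc : Local G v) where

  open LocalFacts proper girth antipodes loc

  private
    record MLine (x : Fin 3 × Bool) : Set where
      field
        line : Fin n
        partner : Fin 3 × Bool
        nbhd : Neighbours G line v' (Q x) (Q partner)

    -- Opaque so that conversion checking never unfolds the choice of M-lines.
    abstract
      m-line : ∀ x → MLine x
      m-line x with D2Adj⇒path (shared (Q-D2 x))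
      ... | w , v'~w , w~Qx with neighbours-via₂ cubic (Adj-sym G v'~w) w~Qx (v'≢Q x)
      ...   | t , N with collinear-points (Q-reach x) w~Qx (Neighbours.adj₃ N) (Neighbours.y≢z N)
      ...     | inj₁ refl =
        ⊥-elim (¬D2Adj (D2Adj-intro proper (Adj-sym G (Neighbours.adj₃ N)) (Neighbours.adj₁ N) v≢v'))
      ...     | inj₂ (inj₁ refl) = ⊥-elim (Neighbours.x≢z N refl)
      ...     | inj₂ (inj₂ (y , refl)) = record { line = w ; partner = y ; nbhd = N }

    μ : Fin 3 × Bool → Fin n
    μ x = MLine.line (m-line x)

    π : Fin 3 × Bool → Fin 3 × Bool
    π x = MLine.partner (m-line x)

    μ-nbhd : ∀ x → Neighbours G (μ x) v' (Q x) (Q (π x))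
    μ-nbhd x = MLine.nbhd (m-line x)

    π-crosses : ∀ x → proj₁ (π x) ≢ proj₁ x
    π-crosses x e = [ (λ v'≡v → v≢v' (sym v'≡v)) , (λ (_ , v'≡Q) → v'≢Q _ v'≡Q) ]′
                      (on-L (subst (λ w → Adj G w v') μ≡L (Neighbours.adj₁ (μ-nbhd x))))
      where
        μ≡L : μ x ≡ L (proj₁ x)
        μ≡L = same-line (Neighbours.y≢z (μ-nbhd x)) (Neighbours.adj₂ (μ-nbhd x)) (Neighbours.adj₃ (μ-nbhd x))
                (L~Q x) (subst (λ ℓ → Adj G (L ℓ) (Q (π x))) e (L~Q (π x)))

    π-involutive : ∀ x → π (π x) ≡ x
    π-involutive x =
      on-μ (Neighbours.only (μ-nbhd x) (subst (λ w → Adj G w (Q (π (π x)))) μ≡μ (Neighbours.adj₃ (μ-nbhd (π x)))))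
      where
        μ≡μ : μ (π x) ≡ μ x
        μ≡μ = same-line (v'≢Q (π x)) (Neighbours.adj₁ (μ-nbhd (π x))) (Neighbours.adj₂ (μ-nbhd (π x)))
                (Neighbours.adj₁ (μ-nbhd x)) (Neighbours.adj₃ (μ-nbhd x))
        on-μ : Q (π (π x)) ≡ v' ⊎ Q (π (π x)) ≡ Q x ⊎ Q (π (π x)) ≡ Q (π x) → π (π x) ≡ x
        on-μ (inj₁ e) = ⊥-elim (v'≢Q _ (sym e))
        on-μ (inj₂ (inj₁ e)) = Q-injective e
        on-μ (inj₂ (inj₂ e)) = ⊥-elim (Neighbours.y≢z (μ-nbhd (π x)) (sym e))

  skeleton : Skeleton G v v'
  skeleton = record
    { local = flip-sides loc t
    ; M = λ ℓ → μ (ℓ , not (t ℓ))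
    ; M-nbhd = λ ℓ → subst (Neighbours G (μ (ℓ , not (t ℓ))) v' (Q (ℓ , not (t ℓ))) ∘ Q)
                        (pairing-normal-form π π-involutive π-crosses ℓ) (μ-nbhd (ℓ , not (t ℓ))) }
    where
      t = flips π π-involutive π-crosses

module Embedding {G : Graph n} (cubic : Cubic G) {col : Fin n → Bool} (proper : ∀ u w → Adj G u w → col u ≢ col w)
  (girth : GirthAtLeast G 5) {v v'} (antipodes : Antipodes G v v') (S : Skeleton G v v') where

  open Skeleton S
  open LocalFacts proper girth antipodes local

  M-index : Fin 3 × Bool → Fin 3
  M-index (ℓ , true) = ℓ
  M-index (ℓ , false) = prev ℓ

  M-through : ∀ x → Neighbours G (M (M-index x)) v' (Q x) (Q (mate x))
  M-through (ℓ , true) = M-nbhd ℓ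
  M-through (0F , false) = swap₂₃ G (M-nbhd 2F)
  M-through (1F , false) = swap₂₃ G (M-nbhd 0F)
  M-through (2F , false) = swap₂₃ G (M-nbhd 1F)

  L≢M : ∀ ℓ k → L ℓ ≢ M k
  L≢M ℓ k e with Neighbours.only (M-nbhd k) (subst (λ w → Adj G w v) e (Adj-sym G (v~L ℓ)))
  ... | inj₁ v≡v' = v≢v' v≡v'
  ... | inj₂ (inj₁ v≡Q) = v≢Q _ v≡Q
  ... | inj₂ (inj₂ v≡Q) = v≢Q _ v≡Q

  -- The L- and M-lines carry only two Q-points each, so a line through three Q-points is none of them.
  not-collinear : ∀ {w x y z} → Neighbours G w (Q x) (Q y) (Q z) → ¬ Collinear x y
  not-collinear {w} {x} {y} {z} W (inj₁ same) =
    three-on-a-line same (sym (Q-on-L (subst (λ w → Adj G w (Q z)) w≡L adj₃)))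
      (x≢y ∘ cong Q) (x≢z ∘ cong Q) (y≢z ∘ cong Q)
    where
      open Neighbours W
      w≡L : w ≡ L (proj₁ x)
      w≡L = same-line x≢y adj₁ adj₂ (L~Q x) (subst (λ ℓ → Adj G (L ℓ) (Q y)) (sym same) (L~Q y))
  not-collinear {w} {x} {y} {z} W (inj₂ refl)
    with Neighbours.only (M-through x) (subst (λ w → Adj G w (Q z)) w≡M adj₃)
    where
      open Neighbours W
      w≡M : w ≡ M (M-index x)
      w≡M = same-line x≢y adj₁ adj₂ (Neighbours.adj₂ (M-through x)) (Neighbours.adj₃ (M-through x))
  ... | inj₁ Qz≡v' = v'≢Q z (sym Qz≡v')
  ... | inj₂ (inj₁ e) = Neighbours.x≢z W (sym e)
  ... | inj₂ (inj₂ e) = Neighbours.y≢z W (sym e)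

  transversal-meets-only-Q : ∀ {w x a} → Adj G w (Q x) → L (proj₁ x) ≢ w → M (M-index x) ≢ w →
                             Adj G w a → Q x ≢ a → ∃ λ y → a ≡ Q y
  transversal-meets-only-Q {w} {x} w~Qx L≢w M≢w w~a Qx≢a with collinear-points (Q-reach x) w~Qx w~a Qx≢a
  ... | inj₁ refl = ⊥-elim (L≢w (same-line (v≢Q x) (Adj-sym G (v~L (proj₁ x))) (L~Q x) w~a w~Qx))
  ... | inj₂ (inj₁ refl) = ⊥-elim (M≢w (same-line (v'≢Q x)
                             (Neighbours.adj₁ (M-through x)) (Neighbours.adj₂ (M-through x)) w~a w~Qx))
  ... | inj₂ (inj₂ Q-point) = Q-point

  R-line : ∀ s → ∃ λ w → Neighbours G w (Q (0F , s)) (Q (1F , s)) (Q (2F , s))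
  R-line s with neighbours-via₂ {G = G} cubic (Adj-sym G (L~Q (0F , s)))
                  (Adj-sym G (Neighbours.adj₂ (M-through (0F , s)))) (L≢M 0F (M-index (0F , s)))
  ... | w , N with neighbours-via {G = G} cubic (Adj-sym G (Neighbours.adj₃ N))
  ... | a , b , W with on-w (Neighbours.adj₂ W) (Neighbours.x≢y W) | on-w (Neighbours.adj₃ W) (Neighbours.x≢z W)
    where
      on-w : ∀ {a} → Adj G w a → Q (0F , s) ≢ a → ∃ λ y → a ≡ Q y
      on-w = transversal-meets-only-Q (Neighbours.adj₁ W) (Neighbours.x≢z N) (Neighbours.y≢z N)
  ... | y , refl | z , refl
    with non-collinear-triple s y z
           (not-collinear W) (not-collinear (swap₂₃ G W)) (not-collinear (swap₂₃ G (swap₁₂ G W)))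
  ... | inj₁ (refl , refl) = w , W
  ... | inj₂ (refl , refl) = w , swap₂₃ G W

  -- Opaque, like m-line.
  abstract
    R : Bool → Fin n
    R s = proj₁ (R-line s)

    R-nbhd : ∀ s → Neighbours G (R s) (Q (0F , s)) (Q (1F , s)) (Q (2F , s))
    R-nbhd s = proj₂ (R-line s)

  point : Point → Fin n
  point p₀ = v
  point p₁ = v'
  point (q ℓ s) = Q (ℓ , s)

  line : Line → Fin n
  line (l ℓ) = L ℓ
  line (m ℓ) = M ℓ
  line (r s) = R s

  line-nbhd : ∀ b → Neighbours G (line b) (point (pointsOn b 0F)) (point (pointsOn b 1F)) (point (pointsOn b 2F))
  line-nbhd (l ℓ) = L-nbhd ℓ
  line-nbhd (m ℓ) = M-nbhd ℓ
  line-nbhd (r s) = R-nbhd s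

  line~point : ∀ b i → Adj G (line b) (point (pointsOn b i))
  line~point b 0F = Neighbours.adj₁ (line-nbhd b)
  line~point b 1F = Neighbours.adj₂ (line-nbhd b)
  line~point b 2F = Neighbours.adj₃ (line-nbhd b)

  point-injective : ∀ {a a'} → point a ≡ point a' → a ≡ a'
  point-injective {p₀} {p₀} _ = refl
  point-injective {p₀} {p₁} e = ⊥-elim (v≢v' e)
  point-injective {p₀} {q _ _} e = ⊥-elim (v≢Q _ e)
  point-injective {p₁} {p₀} e = ⊥-elim (v≢v' (sym e))
  point-injective {p₁} {p₁} _ = refl
  point-injective {p₁} {q _ _} e = ⊥-elim (v'≢Q _ e)
  point-injective {q _ _} {p₀} e = ⊥-elim (v≢Q _ (sym e))
  point-injective {q _ _} {p₁} e = ⊥-elim (v'≢Q _ (sym e))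
  point-injective {q _ _} {q _ _} e with Q-injective e
  ... | refl = refl

  points-of-equal-lines : ∀ b b' → line b ≡ line b' → ∀ i → ∃ λ j → pointsOn b' j ≡ pointsOn b i
  points-of-equal-lines b b' e i with Neighbours.only (line-nbhd b') (subst (λ w → Adj G w _) e (line~point b i))
  ... | inj₁ e' = 0F , point-injective (sym e')
  ... | inj₂ (inj₁ e') = 1F , point-injective (sym e')
  ... | inj₂ (inj₂ e') = 2F , point-injective (sym e')

  line-injective : ∀ {b b'} → line b ≡ line b' → b ≡ b'
  line-injective {l ℓ} {l k} e = cong l (L-injective e)
  line-injective {l ℓ} {m k} e = ⊥-elim (p₀∉m (points-of-equal-lines (l ℓ) (m k) e 0F))
  line-injective {l ℓ} {r s} e with points-of-equal-lines (l ℓ) (r s) e 0F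
  ... | _ , ()
  line-injective {m ℓ} {l k} e = ⊥-elim (p₁∉l (points-of-equal-lines (m ℓ) (l k) e 0F))
  line-injective {m ℓ} {m k} e with points-of-equal-lines (m ℓ) (m k) e 1F
  ... | 1F , refl = refl
  ... | 2F , ()
  ... | 0F , ()
  line-injective {m ℓ} {r s} e with points-of-equal-lines (m ℓ) (r s) e 0F
  ... | _ , ()
  line-injective {r s} {l k} e with points-of-equal-lines (l k) (r s) (sym e) 0F
  ... | _ , ()
  line-injective {r s} {m k} e with points-of-equal-lines (m k) (r s) (sym e) 0F
  ... | _ , ()
  line-injective {r s} {r s'} e with points-of-equal-lines (r s) (r s') e 0F
  ... | _ , refl = refl

  point-colour : ∀ a → col (point a) ≡ col v
  point-colour p₀ = refl
  point-colour p₁ = trans (D2Reach⇒same-colour proper (shared (Q-D2 (0F , false)) ◅ ε))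
                          (sym (D2Reach⇒same-colour proper (Q-reach (0F , false))))
  point-colour (q ℓ s) = sym (D2Reach⇒same-colour proper (Q-reach (ℓ , s)))

  point≢line : ∀ a b → point a ≢ line b
  point≢line a b e = proper (line b) (point (pointsOn b 0F)) (line~point b 0F)
    (trans (sym (cong col e)) (trans (point-colour a) (sym (point-colour (pointsOn b 0F)))))

  vertex : Point ⊎ Line → Fin n
  vertex = [ point , line ]′

  vertex-injective : ∀ {a a'} → vertex a ≡ vertex a' → a ≡ a'
  vertex-injective {inj₁ a} {inj₁ a'} e = cong inj₁ (point-injective e)
  vertex-injective {inj₁ a} {inj₂ b} e = ⊥-elim (point≢line a b e)
  vertex-injective {inj₂ b} {inj₁ a} e = ⊥-elim (point≢line a b (sym e))
  vertex-injective {inj₂ b} {inj₂ b'} e = cong inj₂ (line-injective e)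

  ψ : Label → Fin n
  ψ = vertex ∘ unlabel

  ψ-injective : ∀ {x y} → ψ x ≡ ψ y → x ≡ y
  ψ-injective {x} {y} e = begin
    x                 ≡⟨ sym (label-unlabel x) ⟩
    label (unlabel x) ≡⟨ cong label (vertex-injective e) ⟩
    label (unlabel y) ≡⟨ label-unlabel y ⟩
    y                 ∎
    where open ≡-Reasoning

  ψ-hom : ∀ x y → mkAdj x y ≡ true → Adj G (ψ x) (ψ y)
  ψ-hom x y e = [ incidence (unlabel x) y , Adj-sym G ∘ incidence (unlabel y) x ]′ (mk-edges-are-incidences x y e)
    where
      incidence : ∀ a y → OnLine a y → Adj G (vertex a) (ψ y)
      incidence (inj₂ b) _ (i , refl) rewrite unlabel-label (inj₁ (pointsOn b i)) = line~point b i

  is-Möbius–Kantor : Connected G → IsMobiusKantor G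
  is-Möbius–Kantor connected = injective-hom⇒iso cubic connected mkAdj mk-neighbours
    mk-neighbours-adjacent mk-neighbours-injective ψ ψ-injective ψ-hom (0F , false)

mainTheorem1 : ∀ (n : ℕ) (G : Graph n) → Connected G → Cubic G → Bipartite G
    → GirthAtLeast G 6 → HasCocktailD2Component G → IsMobiusKantor G
mainTheorem1 n G connected cubic (col , proper) girth (v , _ , cocktail) =
  Embedding.is-Möbius–Kantor cubic proper girth₅ antipodes
    (skeleton cubic proper girth₅ antipodes (local-at cubic v)) connected
  where
    girth₅ : GirthAtLeast G 5
    girth₅ k k<5 = girth k (m<n⇒m<1+n k<5)
    antipodes : Antipodes G v _
    antipodes = proj₂ (cocktail-antipodes cocktail)
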